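{- There exists an infinite family of path-pairable planar graphs $G$ such that, writing $n=|V(G)|$, the maximum degree satisfies $\Delta(G)=\frac{2}{3}n$.
   Context: All graphs are simple and undirected. A graph $G$ on $n$ vertices ($n$ even) is path-pairable if for every pairing of its vertices (i.e. every partition of $V(G)$ into $n/2$ unordered pairs $\{x_i,y_i\}$), there exist pairwise edge-disjoint paths $P_1,\dots,P_{n/2}$ in $G$ such that $P_i$ joins $x_i$ and $y_i$ for each $i$. -}

module Defs where

open import Data.Bool using (Bool; true; false)
open import Data.Nat using (ℕ; _*_; _⊔_)
open import Data.Fin using (Fin)
open import Data.List using (List; []; _∷_; length; filterᵇ; map; foldr; allFin)
open import Data.List.Membership.Propositional using (_∈_)
open import Data.List.Relation.Unary.Unique.Propositional using (Unique)
open import Data.Product using (Σ; ∃; _×_; _,_; uncurry)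
open import Data.Sum using (_⊎_)
open import Data.Rational using (ℚ; 0ℚ; 1ℚ; _≤_; _+_; _-_) renaming (_*_ to _*ℚ_)
open import Function.Definitions using (Injective; Bijective)
open import Relation.Binary.PropositionalEquality using (_≡_)
open import Relation.Nullary using (¬_)

record Graph (n : ℕ) : Set where
  field
    adj    : Fin n → Fin n → Bool
    sym    : ∀ u v → adj u v ≡ adj v u
    irrefl : ∀ u → adj u u ≡ false
open Graph public

module _ {n : ℕ} (G : Graph n) where

  Adj : Fin n → Fin n → Set
  Adj u v = adj G u v ≡ true

  degree : Fin n → ℕ
  degree v = length (filterᵇ (adj G v) (allFin n))

  maxDegree : ℕ
  maxDegree = foldr _⊔_ 0 (map degree (allFin n))

  data Walk : Fin n → Fin n → Set where
    nil  : ∀ x → Walk x x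
    cons : ∀ {x y z} → Adj x y → Walk y z → Walk x z

  vertices : ∀ {x y} → Walk x y → List (Fin n)
  vertices (nil x) = x ∷ []
  vertices (cons {x} _ w) = x ∷ vertices w

  edges : ∀ {x y} → Walk x y → List (Fin n × Fin n)
  edges (nil x) = []
  edges (cons {x} {y} _ w) = (x , y) ∷ edges w

  record Path (x y : Fin n) : Set where
    field
      walk   : Walk x y
      unique : Unique (vertices walk)
  open Path public

  SameEdge : Fin n × Fin n → Fin n × Fin n → Set
  SameEdge (a , b) (c , d) = (a ≡ c × b ≡ d) ⊎ (a ≡ d × b ≡ c)

  EdgeDisjoint : ∀ {x y x' y'} → Path x y → Path x' y' → Set
  EdgeDisjoint P Q = ∀ e f → e ∈ edges (walk P) → f ∈ edges (walk Q) → ¬ SameEdge e f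

-- Pairings: a partition of Fin n into k unordered pairs {end i false, end i true}
-- (every vertex is an end of exactly one pair, exactly once)

record Pairing (n : ℕ) : Set where
  field
    k   : ℕ
    end : Fin k → Bool → Fin n
    bij : Bijective _≡_ _≡_ (uncurry end)
open Pairing public

PathPairable : ∀ {n} → Graph n → Set
PathPairable {n} G =
  (∃ λ m → n ≡ 2 * m) ×
  ((p : Pairing n) →
     Σ ((i : Fin (k p)) → Path G (end p i false) (end p i true)) λ P →
       ∀ i j → ¬ i ≡ j → EdgeDisjoint G (P i) (P j))

-- Planarity: a crossing-free straight-line drawing with rational coordinates

Point : Set
Point = ℚ × ℚ

segPt : Point → Point → ℚ → Point
segPt (a₁ , a₂) (b₁ , b₂) t =
  (((1ℚ - t) *ℚ a₁) + (t *ℚ b₁)) , (((1ℚ - t) *ℚ a₂) + (t *ℚ b₂))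

InUnit : ℚ → Set
InUnit t = (0ℚ ≤ t) × (t ≤ 1ℚ)

record PlanarDrawing {n : ℕ} (G : Graph n) : Set where
  field
    pos       : Fin n → Point
    pos-inj   : Injective _≡_ _≡_ pos
    noVertexOnEdge : ∀ u v w t → Adj G u v → InUnit t →
                     segPt (pos u) (pos v) t ≡ pos w → (w ≡ u ⊎ w ≡ v)
    noCrossing : ∀ u v w x t s → Adj G u v → Adj G w x → ¬ SameEdge G (u , v) (w , x) →
                 InUnit t → InUnit s → segPt (pos u) (pos v) t ≡ segPt (pos w) (pos x) s →
                 ∃ λ z → (z ≡ u ⊎ z ≡ v) × (z ≡ w ⊎ z ≡ x) ×
                          segPt (pos u) (pos v) t ≡ pos z

Planar : ∀ {n} → Graph n → Set
Planar G = PlanarDrawing G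

-- G_k consists of a triangle on three hubs h₀, h₁, h₂ together with, for every colour i,
-- k − 1 leaves of colour i, each joined to the two hubs other than h_i. It has n = 3k
-- vertices, the hubs have degree 2k = 2n/3 and the leaves degree 2.
--
-- Path-pairability: orient the triangle cyclically, let each hub own its outgoing triangle
-- edge and each leaf its two edges. Any two vertices are joined by a path of length at most
-- two (through a suitable hub) using only edges owned by its own ends; since every vertex
-- is an end of exactly one pair, the paths of different pairs are edge-disjoint.
--
-- Planarity: the hubs sit at (0,0), (2,0), (0,2) and the leaves of colour i on a ray beyond
-- the side opposite h_i. Any two edges are separated by a line meeting them in at most a
-- common end: the line of a triangle side, the line of a ray, or the line of an edge itself.
module Submission where

open import Defs hiding (sym)

module Combinatorics where

  open import Data.Bool using (Bool; true; false; not; _∧_; _∨_; if_then_else_)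
  open import Data.Bool.Properties using (∨-comm; ∧-zeroʳ)
  open import Data.Fin using (Fin; zero; suc; toℕ)
  open import Data.Fin.Properties using (toℕ-injective)
  open import Data.List using ([]; _∷_; length; filterᵇ; map; foldr; allFin; tabulate)
  open import Data.List.Membership.Propositional using (_∈_)
  open import Data.List.Membership.Propositional.Properties using (∈-map⁺; ∈-allFin)
  open import Data.List.Relation.Unary.Any using (here; there)
  open import Data.List.Relation.Unary.All using ([]; _∷_)
  open import Data.List.Relation.Unary.AllPairs using ([]; _∷_)
  open import Data.Nat using (ℕ; zero; suc; _+_; _*_; _≤_; _⊔_; z≤n)
  open import Data.Nat.Properties using (⊔-lub; m≤m⊔n; m≤n⊔m; m≤n*m; ≤-refl; ≤-trans; ≤-antisym)
  open import Data.Nat.Tactic.RingSolver using (solve-∀)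
  open import Data.Product using (Σ; ∃; _×_; _,_; proj₁; proj₂)
  open import Data.Sum using (_⊎_; inj₁; inj₂; [_,_]′)
  open import Function using (_∘_)
  open import Function.Definitions using (Injective)
  open import Relation.Binary.Definitions using (DecidableEquality)
  open import Relation.Binary.PropositionalEquality
    using (_≡_; _≢_; refl; sym; trans; cong; cong₂; subst₂; ≢-sym)
  open import Relation.Nullary using (yes; no; does; contradiction)
  open import Relation.Nullary.Decidable using (dec-true; dec-false)

  module _ {n : ℕ} (p : Pairing n) where

    end-injective : ∀ {i j b b′} → end p i b ≡ end p j b′ → i ≡ j
    end-injective eq = cong proj₁ (proj₁ (bij p) eq)

    ends-distinct : ∀ i → end p i false ≢ end p i true
    ends-distinct i eq with cong proj₂ (proj₁ (bij p) eq)
    ... | ()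

  module _ {n : ℕ} (G : Graph n) where

    Adj-edges : ∀ {s t} (w : Walk G s t) {x y} → (x , y) ∈ edges G w → Adj G x y
    Adj-edges (cons xy _) (here refl) = xy
    Adj-edges (cons _ w)  (there e∈)  = Adj-edges w e∈

    module Ownership (owner : Fin n → Fin n → Fin n) where

      OwnedPath : Fin n → Fin n → Set
      OwnedPath a b =
        Σ (Path G a b) λ P → ∀ {x y} → (x , y) ∈ edges G (walk P) → owner x y ≡ a ⊎ owner x y ≡ b

      oneEdge : ∀ {a b} → a ≢ b → Adj G a b → owner a b ≡ a ⊎ owner a b ≡ b → OwnedPath a b
      oneEdge {b = b} a≢b ab owned =
        record { walk = cons ab (nil b) ; unique = (a≢b ∷ []) ∷ [] ∷ [] } ,
        λ { (here refl) → owned }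

      twoEdges : ∀ {a h b} → a ≢ h → a ≢ b → h ≢ b → Adj G a h → Adj G h b →
                 owner a h ≡ a → owner h b ≡ b → OwnedPath a b
      twoEdges {b = b} a≢h a≢b h≢b ah hb ah-owned hb-owned =
        record { walk   = cons ah (cons hb (nil b))
               ; unique = (a≢h ∷ a≢b ∷ []) ∷ (h≢b ∷ []) ∷ [] ∷ [] } ,
        λ { (here refl) → inj₁ ah-owned ; (there (here refl)) → inj₂ hb-owned }

      pathPairable-byOwnership : (∀ x y → Adj G x y → owner x y ≡ owner y x) →
                                 (∃ λ m → n ≡ 2 * m) →
                                 (∀ a b → a ≢ b → OwnedPath a b) → PathPairable G
      pathPairable-byOwnership owner-sym even route = even , λ p → path p , disjoint p
        where
        owned : (p : Pairing n) → ∀ i → OwnedPath (end p i false) (end p i true)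
        owned p i = route _ _ (ends-distinct p i)

        path : (p : Pairing n) → ∀ i → Path G (end p i false) (end p i true)
        path p i = proj₁ (owned p i)

        ownedByEnd : ∀ p i {x y} → (x , y) ∈ edges G (walk (path p i)) → ∃ λ b → owner x y ≡ end p i b
        ownedByEnd p i e∈ = [ (false ,_) , (true ,_) ]′ (proj₂ (owned p i) e∈)

        owner-sameEdge : ∀ {x y x′ y′} → Adj G x′ y′ → SameEdge G (x , y) (x′ , y′) →
                         owner x y ≡ owner x′ y′
        owner-sameEdge _  (inj₁ (refl , refl)) = refl
        owner-sameEdge xy (inj₂ (refl , refl)) = sym (owner-sym _ _ xy)

        disjoint : ∀ p i j → i ≢ j → EdgeDisjoint G (path p i) (path p j)
        disjoint p i j i≢j _ _ e∈ f∈ same with ownedByEnd p i e∈ | ownedByEnd p j f∈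
        ... | _ , o | _ , o′ =
          i≢j (end-injective p (trans (sym o) (trans (owner-sameEdge (Adj-edges _ f∈) same) o′)))

  count : ∀ {n} → (Fin n → Bool) → ℕ
  count {zero}  _ = 0
  count {suc n} p = (if p zero then 1 else 0) + count (p ∘ suc)

  count-false : ∀ {n} → count {n} (λ _ → false) ≡ 0
  count-false {zero}  = refl
  count-false {suc n} = count-false {n}

  length-filterᵇ-tabulate : ∀ {A : Set} {n} (f : Fin n → A) (p : A → Bool) →
                            length (filterᵇ p (tabulate f)) ≡ count (p ∘ f)
  length-filterᵇ-tabulate {n = zero}  f p = refl
  length-filterᵇ-tabulate {n = suc n} f p with p (f zero)
  ... | true  = cong suc (length-filterᵇ-tabulate (f ∘ suc) p)
  ... | false = length-filterᵇ-tabulate (f ∘ suc) p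

  degree-count : ∀ {n} (G : Graph n) v → degree G v ≡ count (adj G v)
  degree-count G v = length-filterᵇ-tabulate (λ u → u) (adj G v)

  ≤-foldr-⊔ : ∀ {x xs} → x ∈ xs → x ≤ foldr _⊔_ 0 xs
  ≤-foldr-⊔ (here refl) = m≤m⊔n _ _
  ≤-foldr-⊔ {xs = y ∷ _} (there x∈) = ≤-trans (≤-foldr-⊔ x∈) (m≤n⊔m y _)

  foldr-⊔-≤ : ∀ {A : Set} {k} (f : A → ℕ) xs → (∀ x → f x ≤ k) → foldr _⊔_ 0 (map f xs) ≤ k
  foldr-⊔-≤ f []       _     = z≤n
  foldr-⊔-≤ f (x ∷ xs) f≤k = ⊔-lub (f≤k x) (foldr-⊔-≤ f xs f≤k)

  maxDegree-≡ : ∀ {n} (G : Graph n) v → (∀ u → degree G u ≤ degree G v) → maxDegree G ≡ degree G v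
  maxDegree-≡ {n} G v maximal =
    ≤-antisym (foldr-⊔-≤ (degree G) (allFin n) maximal) (≤-foldr-⊔ (∈-map⁺ (degree G) (∈-allFin v)))

  data Colour : Set where
    c₀ c₁ c₂ : Colour

  _≟ᶜ_ : DecidableEquality Colour
  c₀ ≟ᶜ c₀ = yes refl
  c₁ ≟ᶜ c₁ = yes refl
  c₂ ≟ᶜ c₂ = yes refl
  c₀ ≟ᶜ c₁ = no λ ()
  c₀ ≟ᶜ c₂ = no λ ()
  c₁ ≟ᶜ c₀ = no λ ()
  c₁ ≟ᶜ c₂ = no λ ()
  c₂ ≟ᶜ c₀ = no λ ()
  c₂ ≟ᶜ c₁ = no λ ()

  next : Colour → Colour
  next c₀ = c₁
  next c₁ = c₂
  next c₂ = c₀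

  prev : Colour → Colour
  prev c = next (next c)

  next≢ : ∀ c → next c ≢ c
  next≢ c₀ ()
  next≢ c₁ ()
  next≢ c₂ ()

  prev≢ : ∀ c → prev c ≢ c
  prev≢ c₀ ()
  prev≢ c₁ ()
  prev≢ c₂ ()

  colour-cases : ∀ {c d} → c ≢ d → d ≡ next c ⊎ d ≡ prev c
  colour-cases {c₀} {c₁} _ = inj₁ refl
  colour-cases {c₀} {c₂} _ = inj₂ refl
  colour-cases {c₁} {c₂} _ = inj₁ refl
  colour-cases {c₁} {c₀} _ = inj₂ refl
  colour-cases {c₂} {c₀} _ = inj₁ refl
  colour-cases {c₂} {c₁} _ = inj₂ refl
  colour-cases {c₀} {c₀} c≢c = contradiction refl c≢c
  colour-cases {c₁} {c₁} c≢c = contradiction refl c≢c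
  colour-cases {c₂} {c₂} c≢c = contradiction refl c≢c

  third : (c d : Colour) → ∃ λ e → e ≢ c × e ≢ d
  third c₀ c₀ = c₁ , (λ ()) , (λ ())
  third c₀ c₁ = c₂ , (λ ()) , (λ ())
  third c₀ c₂ = c₁ , (λ ()) , (λ ())
  third c₁ c₀ = c₂ , (λ ()) , (λ ())
  third c₁ c₁ = c₀ , (λ ()) , (λ ())
  third c₁ c₂ = c₀ , (λ ()) , (λ ())
  third c₂ c₀ = c₁ , (λ ()) , (λ ())
  third c₂ c₁ = c₀ , (λ ()) , (λ ())
  third c₂ c₂ = c₀ , (λ ()) , (λ ())

  Distinct : Colour → Colour → Bool
  Distinct c d = not (does (c ≟ᶜ d))

  ≢⇒Distinct : ∀ {c d} → c ≢ d → Distinct c d ≡ true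
  ≢⇒Distinct {c} {d} c≢d = cong not (dec-false (c ≟ᶜ d) c≢d)

  Distinct⇒≢ : ∀ {c d} → Distinct c d ≡ true → c ≢ d
  Distinct⇒≢ {c} eq refl with c ≟ᶜ c
  Distinct⇒≢ () refl | yes _
  Distinct⇒≢ _  refl | no c≢c = c≢c refl

  Distinct-sym : ∀ c d → Distinct c d ≡ Distinct d c
  Distinct-sym c d with c ≟ᶜ d
  ... | yes refl = cong not (sym (dec-true (c ≟ᶜ c) refl))
  ... | no c≢d  = sym (≢⇒Distinct (≢-sym c≢d))

  data Label : Set where
    hub  : Colour → Label
    leaf : Colour → ℕ → Label

  colour : Label → Colour
  colour (hub c)    = c
  colour (leaf c _) = c

  level : Label → ℕ
  level (hub _)    = 0
  level (leaf _ q) = suc q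

  isHub : Label → Bool
  isHub (hub _)    = true
  isHub (leaf _ _) = false

  adjacent : Label → Label → Bool
  adjacent d e = (isHub d ∨ isHub e) ∧ Distinct (colour d) (colour e)

  adjacent-sym : ∀ d e → adjacent d e ≡ adjacent e d
  adjacent-sym d e = cong₂ _∧_ (∨-comm (isHub d) (isHub e)) (Distinct-sym (colour d) (colour e))

  adjacent-irrefl : ∀ d → adjacent d d ≡ false
  adjacent-irrefl d rewrite dec-true (colour d ≟ᶜ colour d) refl = ∧-zeroʳ _

  -- Vertex 3m + i has colour cᵢ and level m: vertices 0, 1, 2 are the hubs.
  label : ∀ {n} → Fin n → Label
  label zero                = hub c₀
  label (suc zero)          = hub c₁
  label (suc (suc zero))    = hub c₂
  label (suc (suc (suc v))) = leaf (colour (label v)) (level (label v))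

  colourIndex : Colour → ℕ
  colourIndex c₀ = 0
  colourIndex c₁ = 1
  colourIndex c₂ = 2

  labelIndex : Label → ℕ
  labelIndex d = level d * 3 + colourIndex (colour d)

  labelIndex-label : ∀ {n} (v : Fin n) → labelIndex (label v) ≡ toℕ v
  labelIndex-label zero                = refl
  labelIndex-label (suc zero)          = refl
  labelIndex-label (suc (suc zero))    = refl
  labelIndex-label (suc (suc (suc v))) = cong (3 +_) (labelIndex-label v)

  label-injective : ∀ {n} → Injective _≡_ _≡_ (label {n})
  label-injective {x = u} {v} eq =
    toℕ-injective (trans (sym (labelIndex-label u)) (trans (cong labelIndex eq) (labelIndex-label v)))

  family : ∀ n → Graph n
  family n = record
    { adj    = λ u v → adjacent (label u) (label v)
    ; sym    = λ u v → adjacent-sym (label u) (label v)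
    ; irrefl = λ u → adjacent-irrefl (label u)
    }

  count-colours : ∀ k (p : Colour → Bool) →
                  count {k * 3} (p ∘ colour ∘ label) ≡ k * count {3} (p ∘ colour ∘ label)
  count-colours zero    p = refl
  count-colours (suc k) p =
    trans (cong (λ x → b c₀ + (b c₁ + (b c₂ + x))) (count-colours k p)) (regroup (b c₀) (b c₁) (b c₂) _)
    where
    b : Colour → ℕ
    b c = if p c then 1 else 0
    regroup : ∀ a₀ a₁ a₂ x → a₀ + (a₁ + (a₂ + x)) ≡ a₀ + (a₁ + (a₂ + 0)) + x
    regroup = solve-∀

  count-otherColours : ∀ c → count {3} (Distinct c ∘ colour ∘ label) ≡ 2
  count-otherColours c₀ = refl
  count-otherColours c₁ = refl
  count-otherColours c₂ = refl

  module _ (M : ℕ) where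

    labelDegree : Label → ℕ
    labelDegree (hub _)    = suc M * 2
    labelDegree (leaf _ _) = 2

    count-neighbours : ∀ d → count {suc M * 3} (λ w → adjacent d (label w)) ≡ labelDegree d
    count-neighbours (hub c) =
      trans (count-colours (suc M) (Distinct c)) (cong (suc M *_) (count-otherColours c))
    count-neighbours (leaf c₀ _) = cong (2 +_) (count-false {M * 3})
    count-neighbours (leaf c₁ _) = cong (2 +_) (count-false {M * 3})
    count-neighbours (leaf c₂ _) = cong (2 +_) (count-false {M * 3})

    degree-family : ∀ v → degree (family (suc M * 3)) v ≡ labelDegree (label v)
    degree-family v = trans (degree-count (family (suc M * 3)) v) (count-neighbours (label v))

    maxDegree-family : maxDegree (family (suc M * 3)) ≡ suc M * 2
    maxDegree-family = trans (maxDegree-≡ (family (suc M * 3)) zero bounded) (degree-family zero)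
      where
      bounded : ∀ u → degree (family (suc M * 3)) u ≤ degree (family (suc M * 3)) zero
      bounded u = subst₂ _≤_ (sym (degree-family u)) (sym (degree-family zero)) (labelDegree-≤ (label u))
        where
        labelDegree-≤ : ∀ d → labelDegree d ≤ suc M * 2
        labelDegree-≤ (hub _)    = ≤-refl
        labelDegree-≤ (leaf _ _) = m≤n*m 2 (suc M)

  owns : Label → Label → Bool
  owns (hub c)    (hub d)    = does (d ≟ᶜ next c)
  owns (hub _)    (leaf _ _) = false
  owns (leaf _ _) _          = true

  owns-antisym : ∀ d e → adjacent d e ≡ true → owns d e ≡ not (owns e d)
  owns-antisym (hub c₀)   (hub c₁)   _ = refl
  owns-antisym (hub c₀)   (hub c₂)   _ = refl
  owns-antisym (hub c₁)   (hub c₀)   _ = refl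
  owns-antisym (hub c₁)   (hub c₂)   _ = refl
  owns-antisym (hub c₂)   (hub c₀)   _ = refl
  owns-antisym (hub c₂)   (hub c₁)   _ = refl
  owns-antisym (hub _)    (leaf _ _) _ = refl
  owns-antisym (leaf _ _) (hub _)    _ = refl
  owns-antisym (hub c₀)   (hub c₀)   ()
  owns-antisym (hub c₁)   (hub c₁)   ()
  owns-antisym (hub c₂)   (hub c₂)   ()
  owns-antisym (leaf _ _) (leaf _ _) ()

  module _ (n : ℕ) where

    private
      G : Graph (3 + n)
      G = family (3 + n)

    owner : Fin (3 + n) → Fin (3 + n) → Fin (3 + n)
    owner x y = if owns (label x) (label y) then x else y

    open Ownership G owner

    owner-sym : ∀ x y → Adj G x y → owner x y ≡ owner y x
    owner-sym x y xy with owns (label x) (label y) | owns (label y) (label x)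
                            | owns-antisym (label x) (label y) xy
    ... | true  | false | _  = refl
    ... | false | true  | _  = refl
    ... | true  | true  | ()
    ... | false | false | ()

    owner-end : ∀ x y → owner x y ≡ x ⊎ owner x y ≡ y
    owner-end x y with owns (label x) (label y)
    ... | true  = inj₁ refl
    ... | false = inj₂ refl

    owner-first : ∀ {x y} → owns (label x) (label y) ≡ true → owner x y ≡ x
    owner-first o rewrite o = refl

    owner-second : ∀ {x y} → owns (label x) (label y) ≡ false → owner x y ≡ y
    owner-second o rewrite o = refl

    apart : ∀ {x y : Fin (3 + n)} {d e} → label x ≡ d → label y ≡ e → d ≢ e → x ≢ y
    apart lx ly d≢e x≡y = d≢e (trans (sym lx) (trans (cong label x≡y) ly))

    hubVertex : ∀ c → ∃ λ v → label {3 + n} v ≡ hub c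
    hubVertex c₀ = zero , refl
    hubVertex c₁ = suc zero , refl
    hubVertex c₂ = suc (suc zero) , refl

    Linked : Label → Label → Set
    Linked d e = adjacent d e ≡ true

    direct : ∀ {a b d e} → label a ≡ d → label b ≡ e → a ≢ b → Linked d e → OwnedPath a b
    direct la lb a≢b de = oneEdge a≢b (subst₂ Linked (sym la) (sym lb) de) (owner-end _ _)

    viaHub : ∀ {a b d e} h → label a ≡ d → label b ≡ e → a ≢ b → d ≢ hub h → hub h ≢ e →
             Linked d (hub h) → Linked (hub h) e →
             owns d (hub h) ≡ true → owns (hub h) e ≡ false → OwnedPath a b
    viaHub {a} {b} h la lb a≢b d≢h h≢e dh he o₁ o₂ with hubVertex h
    ... | v , lv =
      twoEdges (apart la lv d≢h) a≢b (apart lv lb h≢e)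
        (subst₂ Linked (sym la) (sym lv) dh) (subst₂ Linked (sym lv) (sym lb) he)
        (owner-first {a} {v} (subst₂ (λ d e → owns d e ≡ true) (sym la) (sym lv) o₁))
        (owner-second {v} {b} (subst₂ (λ d e → owns d e ≡ false) (sym lv) (sym lb) o₂))

    routeLabels : ∀ {a b} d e → label a ≡ d → label b ≡ e → a ≢ b → OwnedPath a b
    routeLabels (hub c) (hub c′) la lb a≢b =
      direct la lb a≢b (≢⇒Distinct {c} {c′} λ { refl → a≢b (label-injective (trans la (sym lb))) })
    routeLabels (hub c) (leaf c′ _) la lb a≢b with c ≟ᶜ c′
    ... | no c≢c′ = direct la lb a≢b (≢⇒Distinct c≢c′)
    ... | yes refl =
      viaHub (next c) la lb a≢b (λ eq → next≢ c (sym (cong colour eq))) (λ ())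
        (≢⇒Distinct {c} (≢-sym (next≢ c))) (≢⇒Distinct {next c} (next≢ c))
        (dec-true (next c ≟ᶜ next c) refl) refl
    routeLabels (leaf c _) (hub c′) la lb a≢b with c ≟ᶜ c′
    ... | no c≢c′ = direct la lb a≢b (≢⇒Distinct c≢c′)
    ... | yes refl =
      viaHub (next c) la lb a≢b (λ ()) (λ eq → next≢ c (cong colour eq))
        (≢⇒Distinct {c} (≢-sym (next≢ c))) (≢⇒Distinct {next c} (next≢ c))
        refl (dec-false (c ≟ᶜ prev c) (≢-sym (prev≢ c)))
    routeLabels (leaf c _) (leaf c′ _) la lb a≢b with third c c′
    ... | h , h≢c , h≢c′ =
      viaHub h la lb a≢b (λ ()) (λ ())
        (≢⇒Distinct {c} {h} (≢-sym h≢c)) (≢⇒Distinct {h} {c′} h≢c′) refl refl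

    family-pathPairable : (∃ λ m → 3 + n ≡ 2 * m) → PathPairable (family (3 + n))
    family-pathPairable even =
      pathPairable-byOwnership owner-sym even λ a b → routeLabels (label a) (label b) refl refl

open Combinatorics

module Geometry where

  open import Data.Bool using (Bool; true; false; if_then_else_)
  open import Data.Fin using (Fin)
  open import Data.Integer using (+[1+_])
  open import Data.List using ([]; _∷_)
  open import Data.Nat using (ℕ)
  import Data.Product
  open import Data.Product using (∃; _×_; _,_)
  open import Data.Rational using (ℚ; 0ℚ; 1ℚ; _+_; _*_; _-_; -_; _≤_; _<_; _≟_; 1/_;
    ≢-nonZero; positive; negative; nonNegative; nonPositive)
  open import Data.Rational.Literals using (fromℤ)
  open import Data.Rational.Properties using (+-*-commutativeRing; <-cmp; ≤-antisym; ≤-reflexive;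
    <-irrefl; <⇒≤; +-mono-≤; +-mono-≤-<; +-mono-<-≤; +-monoˡ-≤; +-monoʳ-≤; +-inverseʳ;
    neg-antimono-≤; *-identityʳ; *-assoc; *-zeroˡ; *-zeroʳ; +-identityˡ; *-inverseʳ;
    nonNegative⁻¹; nonPositive⁻¹; negative⁻¹; positive⁻¹;
    nonNeg*nonNeg⇒nonNeg; nonNeg*nonPos⇒nonPos; pos*neg⇒neg)
  import Data.Sum
  open import Data.Sum using (_⊎_; inj₁; inj₂; [_,_]′)
  open import Function using (_∘_)
  open import Function.Definitions using (Injective)
  open import Level using (0ℓ)
  open import Relation.Binary.Definitions using (tri<; tri≈; tri>)
  open import Relation.Binary.PropositionalEquality
    using (_≡_; _≢_; refl; sym; trans; cong; cong₂; subst; ≢-sym; module ≡-Reasoning)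
  open import Relation.Nullary using (¬_; yes; no; does; contradiction)
  open import Relation.Nullary.Decidable using (dec⇒maybe; dec-true)
  open import Tactic.RingSolver using (solve-∀; solve)
  open import Tactic.RingSolver.Core.AlmostCommutativeRing using (AlmostCommutativeRing; fromCommutativeRing)

  ℚ-ring : AlmostCommutativeRing 0ℓ 0ℓ
  ℚ-ring = fromCommutativeRing +-*-commutativeRing (λ x → dec⇒maybe (0ℚ ≟ x))

  private variable
    p q t : ℚ
    B D P Q X : Point

  p≤q⇒0≤q-p : p ≤ q → 0ℚ ≤ q - p
  p≤q⇒0≤q-p {p} {q} p≤q = subst (_≤ q - p) (+-inverseʳ p) (+-monoˡ-≤ (- p) p≤q)

  0≤p⇒1-p≤1 : 0ℚ ≤ p → 1ℚ - p ≤ 1ℚ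
  0≤p⇒1-p≤1 {p} 0≤p = +-monoʳ-≤ 1ℚ (neg-antimono-≤ 0≤p)

  *-nonNeg : 0ℚ ≤ p → 0ℚ ≤ q → 0ℚ ≤ p * q
  *-nonNeg {p} {q} 0≤p 0≤q =
    nonNegative⁻¹ (p * q) {{nonNeg*nonNeg⇒nonNeg p {{nonNegative 0≤p}} q {{nonNegative 0≤q}}}}

  *-nonNeg-nonPos : 0ℚ ≤ p → q ≤ 0ℚ → p * q ≤ 0ℚ
  *-nonNeg-nonPos {p} {q} 0≤p q≤0 =
    nonPositive⁻¹ (p * q) {{nonNeg*nonPos⇒nonPos p {{nonNegative 0≤p}} q {{nonPositive q≤0}}}}

  *-pos-neg : 0ℚ < p → q < 0ℚ → p * q < 0ℚ
  *-pos-neg {p} {q} 0<p q<0 = negative⁻¹ (p * q) {{pos*neg⇒neg p {{positive 0<p}} q {{negative q<0}}}}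

  p*q≡0⇒p≡0 : q ≢ 0ℚ → p * q ≡ 0ℚ → p ≡ 0ℚ
  p*q≡0⇒p≡0 {q} {p} q≢0 pq≡0 = begin
    p              ≡⟨ *-identityʳ p ⟨
    p * 1ℚ         ≡⟨ cong (p *_) (*-inverseʳ q) ⟨
    p * (q * 1/ q) ≡⟨ *-assoc p q (1/ q) ⟨
    p * q * 1/ q   ≡⟨ cong (_* 1/ q) pq≡0 ⟩
    0ℚ * 1/ q      ≡⟨ *-zeroˡ (1/ q) ⟩
    0ℚ             ∎
    where
    open ≡-Reasoning
    instance _ = ≢-nonZero q≢0

  p-q≡0⇒p≡q : p - q ≡ 0ℚ → p ≡ q
  p-q≡0⇒p≡q {p} {q} p-q≡0 = begin
    p             ≡⟨ solve (p ∷ q ∷ []) ℚ-ring ⟩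
    (p - q) + q   ≡⟨ cong (_+ q) p-q≡0 ⟩
    0ℚ + q        ≡⟨ +-identityˡ q ⟩
    q             ∎
    where open ≡-Reasoning

  Affine : Set
  Affine = ℚ × ℚ × ℚ

  eval : Affine → Point → ℚ
  eval (a , b , c) (x , y) = a * x + b * y + c

  data OnSegment (P Q : Point) : Point → Set where
    at : ∀ t → InUnit t → OnSegment P Q (segPt P Q t)

  private variable
    f : Affine

  segPt-0 : ∀ P Q → segPt P Q 0ℚ ≡ P
  segPt-0 (p₁ , p₂) (q₁ , q₂) =
    cong₂ _,_ (solve (p₁ ∷ q₁ ∷ []) ℚ-ring) (solve (p₂ ∷ q₂ ∷ []) ℚ-ring)

  segPt-flip : ∀ P Q t → segPt Q P (1ℚ - t) ≡ segPt P Q t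
  segPt-flip (p₁ , p₂) (q₁ , q₂) t =
    cong₂ _,_ (solve (p₁ ∷ q₁ ∷ t ∷ []) ℚ-ring) (solve (p₂ ∷ q₂ ∷ t ∷ []) ℚ-ring)

  onSegment-sym : OnSegment P Q X → OnSegment Q P X
  onSegment-sym {P} {Q} (at t (0≤t , t≤1)) =
    subst (OnSegment Q P) (segPt-flip P Q t) (at (1ℚ - t) (p≤q⇒0≤q-p t≤1 , 0≤p⇒1-p≤1 0≤t))

  eval-segPt : ∀ f P Q t → eval f (segPt P Q t) ≡ (1ℚ - t) * eval f P + t * eval f Q
  eval-segPt (a , b , c) (p₁ , p₂) (q₁ , q₂) t = identity a b c p₁ p₂ q₁ q₂ t
    where
    identity : ∀ a b c p₁ p₂ q₁ q₂ t →
      a * ((1ℚ - t) * p₁ + t * q₁) + b * ((1ℚ - t) * p₂ + t * q₂) + c ≡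
      (1ℚ - t) * (a * p₁ + b * p₂ + c) + t * (a * q₁ + b * q₂ + c)
    identity = solve-∀ ℚ-ring

  eval-segPt-fromRoot : ∀ f P Q t → eval f P ≡ 0ℚ → eval f (segPt P Q t) ≡ t * eval f Q
  eval-segPt-fromRoot f P Q t fP≡0 = begin
    eval f (segPt P Q t)                  ≡⟨ eval-segPt f P Q t ⟩
    (1ℚ - t) * eval f P + t * eval f Q    ≡⟨ cong (λ v → (1ℚ - t) * v + t * eval f Q) fP≡0 ⟩
    (1ℚ - t) * 0ℚ + t * eval f Q          ≡⟨ cong (_+ t * eval f Q) (*-zeroʳ (1ℚ - t)) ⟩
    0ℚ + t * eval f Q                     ≡⟨ +-identityˡ (t * eval f Q) ⟩
    t * eval f Q                          ∎
    where open ≡-Reasoning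

  onSegment-nonNeg : ∀ f → 0ℚ ≤ eval f P → 0ℚ ≤ eval f Q → OnSegment P Q X → 0ℚ ≤ eval f X
  onSegment-nonNeg {P} {Q} f 0≤fP 0≤fQ (at t (0≤t , t≤1)) =
    subst (0ℚ ≤_) (sym (eval-segPt f P Q t))
      (+-mono-≤ (*-nonNeg (p≤q⇒0≤q-p t≤1) 0≤fP) (*-nonNeg 0≤t 0≤fQ))

  onSegment-root : ∀ f → eval f P ≡ 0ℚ → eval f Q ≢ 0ℚ → OnSegment P Q X → eval f X ≡ 0ℚ → X ≡ P
  onSegment-root {P} {Q} f fP≡0 fQ≢0 (at t _) fX≡0 = begin
    segPt P Q t   ≡⟨ cong (segPt P Q) (p*q≡0⇒p≡0 {q = eval f Q} {p = t} fQ≢0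
                       (trans (sym (eval-segPt-fromRoot f P Q t fP≡0)) fX≡0)) ⟩
    segPt P Q 0ℚ  ≡⟨ segPt-0 P Q ⟩
    P             ∎
    where open ≡-Reasoning

  onSegment-touch : ∀ f → eval f P ≡ 0ℚ → eval f Q < 0ℚ → OnSegment P Q X → 0ℚ ≤ eval f X → X ≡ P
  onSegment-touch {P} {Q} f fP≡0 fQ<0 on@(at t (0≤t , _)) 0≤fX =
    onSegment-root f fP≡0 (λ fQ≡0 → <-irrefl fQ≡0 fQ<0) on
      (≤-antisym (subst (_≤ 0ℚ) (sym (eval-segPt-fromRoot f P Q t fP≡0)) (*-nonNeg-nonPos 0≤t (<⇒≤ fQ<0)))
                 0≤fX)

  ray : Point → Point → ℚ → Point
  ray (x , y) (dx , dy) t = x + t * dx , y + t * dy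

  slope : Affine → Point → ℚ
  slope (a , b , _) (dx , dy) = a * dx + b * dy

  eval-ray : ∀ f B D t → eval f (ray B D t) ≡ eval f B + t * slope f D
  eval-ray (a , b , c) (x , y) (dx , dy) t = identity a b c x y dx dy t
    where
    identity : ∀ a b c x y dx dy t →
      a * (x + t * dx) + b * (y + t * dy) + c ≡ a * x + b * y + c + t * (a * dx + b * dy)
    identity = solve-∀ ℚ-ring

  ray-negative : ∀ f → eval f B ≤ 0ℚ → slope f D < 0ℚ → 0ℚ < t → eval f (ray B D t) < 0ℚ
  ray-negative {B} {D} {t} f fB≤0 fD<0 0<t =
    subst (_< 0ℚ) (sym (eval-ray f B D t)) (+-mono-≤-< fB≤0 (*-pos-neg 0<t fD<0))

  ray-positive : ∀ f → 0ℚ < eval f B → 0ℚ ≤ slope f D → 0ℚ ≤ t → 0ℚ < eval f (ray B D t)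
  ray-positive {B} {D} {t} f 0<fB 0≤fD 0≤t =
    subst (0ℚ <_) (sym (eval-ray f B D t)) (+-mono-<-≤ 0<fB (*-nonNeg 0≤t 0≤fD))

  lineThrough : Point → Point → Affine
  lineThrough (p₁ , p₂) (q₁ , q₂) = p₂ - q₂ , q₁ - p₁ , p₁ * q₂ - p₂ * q₁

  lineThrough-start : ∀ P Q → eval (lineThrough P Q) P ≡ 0ℚ
  lineThrough-start (p₁ , p₂) (q₁ , q₂) = identity p₁ p₂ q₁ q₂
    where
    identity : ∀ p₁ p₂ q₁ q₂ → (p₂ - q₂) * p₁ + (q₁ - p₁) * p₂ + (p₁ * q₂ - p₂ * q₁) ≡ 0ℚ
    identity = solve-∀ ℚ-ring

  lineThrough-end : ∀ P Q → eval (lineThrough P Q) Q ≡ 0ℚ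
  lineThrough-end (p₁ , p₂) (q₁ , q₂) = identity p₁ p₂ q₁ q₂
    where
    identity : ∀ p₁ p₂ q₁ q₂ → (p₂ - q₂) * q₁ + (q₁ - p₁) * q₂ + (p₁ * q₂ - p₂ * q₁) ≡ 0ℚ
    identity = solve-∀ ℚ-ring

  onSegment-onLine : OnSegment P Q X → eval (lineThrough P Q) X ≡ 0ℚ
  onSegment-onLine {P} {Q} (at t _) =
    trans (eval-segPt-fromRoot (lineThrough P Q) P Q t (lineThrough-start P Q))
          (trans (cong (t *_) (lineThrough-end P Q)) (*-zeroʳ t))

  -- Both sides are the determinant of (B + t D − H, B + s D − H).
  eval-lineThrough-ray : ∀ H B D t s →
    eval (lineThrough H (ray B D t)) (ray B D s) ≡ (s - t) * eval (lineThrough H B) (ray B D 1ℚ)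
  eval-lineThrough-ray (h₁ , h₂) (x , y) (dx , dy) t s = identity h₁ h₂ x y dx dy t s
    where
    identity : ∀ h₁ h₂ x y dx dy t s →
      (h₂ - (y + t * dy)) * (x + s * dx) + ((x + t * dx) - h₁) * (y + s * dy)
        + (h₁ * (y + t * dy) - h₂ * (x + t * dx)) ≡
      (s - t) * ((h₂ - y) * (x + 1ℚ * dx) + (x - h₁) * (y + 1ℚ * dy) + (h₁ * y - h₂ * x))
    identity = solve-∀ ℚ-ring

  data Sign : Set where
    neg zer pos : Sign

  -- On closed rationals signOf computes, so sign facts about the concrete drawing hold by refl.
  signOf : ℚ → Sign
  signOf p with <-cmp p 0ℚ
  ... | tri< _ _ _ = neg
  ... | tri≈ _ _ _ = zer
  ... | tri> _ _ _ = pos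

  signOf-<0 : p < 0ℚ → signOf p ≡ neg
  signOf-<0 {p} p<0 with <-cmp p 0ℚ
  ... | tri< _ _ _    = refl
  ... | tri≈ ¬p<0 _ _ = contradiction p<0 ¬p<0
  ... | tri> ¬p<0 _ _ = contradiction p<0 ¬p<0

  signOf-0< : 0ℚ < p → signOf p ≡ pos
  signOf-0< {p} 0<p with <-cmp p 0ℚ
  ... | tri< _ _ ¬0<p = contradiction 0<p ¬0<p
  ... | tri≈ _ _ ¬0<p = contradiction 0<p ¬0<p
  ... | tri> _ _ _    = refl

  signOf≡neg⇒<0 : signOf p ≡ neg → p < 0ℚ
  signOf≡neg⇒<0 {p} eq with <-cmp p 0ℚ
  signOf≡neg⇒<0 _  | tri< p<0 _ _ = p<0
  signOf≡neg⇒<0 () | tri≈ _ _ _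
  signOf≡neg⇒<0 () | tri> _ _ _

  signOf≡pos⇒0< : signOf p ≡ pos → 0ℚ < p
  signOf≡pos⇒0< {p} eq with <-cmp p 0ℚ
  signOf≡pos⇒0< () | tri< _ _ _
  signOf≡pos⇒0< () | tri≈ _ _ _
  signOf≡pos⇒0< _  | tri> _ _ 0<p = 0<p

  signOf≢pos⇒≤0 : signOf p ≢ pos → p ≤ 0ℚ
  signOf≢pos⇒≤0 {p} ne with <-cmp p 0ℚ
  ... | tri< p<0 _ _ = <⇒≤ p<0
  ... | tri≈ _ p≡0 _ = ≤-reflexive p≡0
  ... | tri> _ _ _   = contradiction refl ne

  signOf≢neg⇒0≤ : signOf p ≢ neg → 0ℚ ≤ p
  signOf≢neg⇒0≤ {p} ne with <-cmp p 0ℚ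
  ... | tri< _ _ _   = contradiction refl ne
  ... | tri≈ _ p≡0 _ = ≤-reflexive (sym p≡0)
  ... | tri> _ _ 0<p = <⇒≤ 0<p

  signOf≢zer⇒≢0 : signOf p ≢ zer → p ≢ 0ℚ
  signOf≢zer⇒≢0 ne p≡0 = ne (cong signOf p≡0)

  signOf-ray-neg : ∀ f B D → signOf (eval f B) ≢ pos → signOf (slope f D) ≡ neg → 0ℚ < t →
                   signOf (eval f (ray B D t)) ≡ neg
  signOf-ray-neg f B D fB fD 0<t = signOf-<0 (ray-negative f (signOf≢pos⇒≤0 fB) (signOf≡neg⇒<0 fD) 0<t)

  signOf-ray-pos : ∀ f B D → signOf (eval f B) ≡ pos → signOf (slope f D) ≢ neg → 0ℚ ≤ t →
                   signOf (eval f (ray B D t)) ≡ pos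
  signOf-ray-pos f B D fB fD 0≤t = signOf-0< (ray-positive f (signOf≡pos⇒0< fB) (signOf≢neg⇒0≤ fD) 0≤t)

  module EdgeDrawing {L E : Set} (source target : E → L) (pos : L → Point) where

    data Endpoint (z : L) (ε : E) : Set where
      atSource : z ≡ source ε → Endpoint z ε
      atTarget : z ≡ target ε → Endpoint z ε

    data Joins (d e : L) (ε : E) : Set where
      forwards  : d ≡ source ε → e ≡ target ε → Joins d e ε
      backwards : d ≡ target ε → e ≡ source ε → Joins d e ε

    OnEdge : E → Point → Set
    OnEdge ε = OnSegment (pos (source ε)) (pos (target ε))

    record Meet (ε ε′ : E) (X : Point) : Set where
      constructor meet
      field
        vertex    : L
        vertex∈ε  : Endpoint vertex ε
        vertex∈ε′ : Endpoint vertex ε′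
        X≡vertex  : X ≡ pos vertex

    VerticesOffEdges : Set
    VerticesOffEdges = ∀ ε w → OnEdge ε (pos w) → Endpoint w ε

    EdgesMeetAtEnds : Set
    EdgesMeetAtEnds = ∀ ε ε′ → ε ≢ ε′ → ∀ {X} → OnEdge ε X → OnEdge ε′ X → Meet ε ε′ X

    Joins-sym : ∀ {d e ε} → Joins d e ε → Joins e d ε
    Joins-sym (forwards  d≡ e≡) = backwards e≡ d≡
    Joins-sym (backwards d≡ e≡) = forwards  e≡ d≡

    Meet-sym : ∀ {ε ε′ X} → Meet ε ε′ X → Meet ε′ ε X
    Meet-sym (meet z z∈ε z∈ε′ X≡z) = meet z z∈ε′ z∈ε X≡z

    onEdge : ∀ {d e ε X} → Joins d e ε → OnSegment (pos d) (pos e) X → OnEdge ε X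
    onEdge (forwards  refl refl) on = on
    onEdge (backwards refl refl) on = onSegment-sym on

    joined : ∀ {d e ε z} → Joins d e ε → Endpoint z ε → z ≡ d ⊎ z ≡ e
    joined (forwards  refl _) (atSource z≡) = inj₁ z≡
    joined (forwards  _ refl) (atTarget z≡) = inj₂ z≡
    joined (backwards _ refl) (atSource z≡) = inj₂ z≡
    joined (backwards refl _) (atTarget z≡) = inj₁ z≡

    sameEnds : ∀ {d e d′ e′ ε} → Joins d e ε → Joins d′ e′ ε →
               (d ≡ d′ × e ≡ e′) ⊎ (d ≡ e′ × e ≡ d′)
    sameEnds (forwards  refl refl) (forwards  refl refl) = inj₁ (refl , refl)
    sameEnds (forwards  refl refl) (backwards refl refl) = inj₂ (refl , refl)
    sameEnds (backwards refl refl) (forwards  refl refl) = inj₂ (refl , refl)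
    sameEnds (backwards refl refl) (backwards refl refl) = inj₁ (refl , refl)

    planar-fromLabelling :
      ∀ {n} (G : Graph n) (label : Fin n → L) → Injective _≡_ _≡_ label → Injective _≡_ _≡_ pos →
      (∀ u v → Adj G u v → ∃ (Joins (label u) (label v))) →
      VerticesOffEdges → EdgesMeetAtEnds → Planar G
    planar-fromLabelling {n} G label label-injective pos-injective edgeOf offEdges meetAtEnds = record
      { pos            = point
      ; pos-inj        = label-injective ∘ pos-injective
      ; noVertexOnEdge = noVertexOnEdge
      ; noCrossing     = noCrossing
      }
      where
      point : Fin n → Point
      point = pos ∘ label

      Segment : Fin n → Fin n → Point → Set
      Segment u v = OnSegment (point u) (point v)

      ends : ∀ u v w {ε} → Joins (label u) (label v) ε → Endpoint (label w) ε → w ≡ u ⊎ w ≡ v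
      ends u v w j w∈ = Data.Sum.map label-injective label-injective (joined j w∈)

      sameEdge : ∀ u v w x {ε} → Joins (label u) (label v) ε → Joins (label w) (label x) ε →
                 SameEdge G (u , v) (w , x)
      sameEdge u v w x j j′ = Data.Sum.map (Data.Product.map label-injective label-injective)
                                           (Data.Product.map label-injective label-injective) (sameEnds j j′)

      noVertexOnEdge : ∀ u v w t → Adj G u v → InUnit t → segPt (point u) (point v) t ≡ point w →
                       w ≡ u ⊎ w ≡ v
      noVertexOnEdge u v w t uv t∈ eq with edgeOf u v uv
      ... | ε , j = ends u v w j (offEdges ε (label w) (onEdge j (subst (Segment u v) eq (at t t∈))))

      noCrossing : ∀ u v w x t s → Adj G u v → Adj G w x → ¬ SameEdge G (u , v) (w , x) →
                   InUnit t → InUnit s → segPt (point u) (point v) t ≡ segPt (point w) (point x) s →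
                   ∃ λ z → (z ≡ u ⊎ z ≡ v) × (z ≡ w ⊎ z ≡ x) × segPt (point u) (point v) t ≡ point z
      noCrossing u v w x t s uv wx notSame t∈ s∈ eq with edgeOf u v uv | edgeOf w x wx
      ... | ε , j | ε′ , j′
        with meetAtEnds ε ε′ (λ { refl → notSame (sameEdge u v w x j j′) }) (onEdge j (at t t∈))
               (onEdge j′ (subst (Segment w x) (sym eq) (at s s∈)))
      ... | meet z z∈ε z∈ε′ X≡z with joined j z∈ε
      ...   | inj₁ refl = u , inj₁ refl , ends w x u j′ z∈ε′ , X≡z
      ...   | inj₂ refl = v , inj₂ refl , ends w x v j′ z∈ε′ , X≡z

  data Edge : Set where
    side  : Colour → Edge
    spoke : Colour → Bool → ℕ → Edge

  hubOf : Colour → Bool → Colour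
  hubOf c false = next c
  hubOf c true  = prev c

  source : Edge → Label
  source (side c)      = hub (next c)
  source (spoke c s _) = hub (hubOf c s)

  target : Edge → Label
  target (side c)      = hub (prev c)
  target (spoke c _ q) = leaf c q

  hubPoint : Colour → Point
  hubPoint c₀ = 0ℚ , 0ℚ
  hubPoint c₁ = 1ℚ + 1ℚ , 0ℚ
  hubPoint c₂ = 0ℚ , 1ℚ + 1ℚ

  rayBase : Colour → Point
  rayBase c₀ = 1ℚ , 1ℚ
  rayBase c₁ = 0ℚ , 1ℚ
  rayBase c₂ = 1ℚ , 0ℚ

  rayDir : Colour → Point
  rayDir c₀ = 1ℚ , 1ℚ
  rayDir c₁ = - 1ℚ , 0ℚ
  rayDir c₂ = 0ℚ , - 1ℚ

  offset : ℕ → ℚ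
  offset q = fromℤ +[1+ q ]

  offset-positive : ∀ q → 0ℚ < offset q
  offset-positive q = positive⁻¹ (offset q)

  offset-injective : ∀ {q r} → offset q ≡ offset r → q ≡ r
  offset-injective refl = refl

  point : Label → Point
  point (hub c)    = hubPoint c
  point (leaf c q) = ray (rayBase c) (rayDir c) (offset q)

  open EdgeDrawing source target point

  sideLine : Colour → Affine
  sideLine c = lineThrough (hubPoint (next c)) (hubPoint (prev c))

  rayLine : Colour → Affine
  rayLine c = lineThrough (ray (rayBase c) (rayDir c) 1ℚ) (ray (rayBase c) (rayDir c) 0ℚ)

  spokeLine : Colour → Bool → ℕ → Affine
  spokeLine c s q = lineThrough (point (hub (hubOf c s))) (point (leaf c q))

  spokeConstant : Colour → Bool → ℚ
  spokeConstant c s = eval (lineThrough (hubPoint (hubOf c s)) (rayBase c)) (ray (rayBase c) (rayDir c) 1ℚ)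

  -- No hub lies on the line of a ray.
  spokeConstant≢0 : ∀ c s → spokeConstant c s ≢ 0ℚ
  spokeConstant≢0 c₀ false ()
  spokeConstant≢0 c₀ true  ()
  spokeConstant≢0 c₁ false ()
  spokeConstant≢0 c₁ true  ()
  spokeConstant≢0 c₂ false ()
  spokeConstant≢0 c₂ true  ()

  spokeLine-leaf : ∀ c s q r → eval (spokeLine c s q) (point (leaf c r)) ≡ 0ℚ → r ≡ q
  spokeLine-leaf c s q r eq =
    offset-injective (p-q≡0⇒p≡q (p*q≡0⇒p≡0 {q = spokeConstant c s} {p = offset r - offset q}
      (spokeConstant≢0 c s)
      (trans (sym (eval-lineThrough-ray (hubPoint (hubOf c s)) (rayBase c) (rayDir c) (offset q) (offset r))) eq)))

  rayLine-leaf : ∀ c q → eval (rayLine c) (point (leaf c q)) ≡ 0ℚ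
  rayLine-leaf c q = begin
    eval (lineThrough h (ray b d 0ℚ)) (ray b d (offset q))   ≡⟨ eval-lineThrough-ray h b d 0ℚ (offset q) ⟩
    (offset q - 0ℚ) * eval (lineThrough h b) h    ≡⟨ cong ((offset q - 0ℚ) *_) (lineThrough-start h b) ⟩
    (offset q - 0ℚ) * 0ℚ                          ≡⟨ *-zeroʳ (offset q - 0ℚ) ⟩
    0ℚ                                            ∎
    where
    open ≡-Reasoning
    b d h : Point
    b = rayBase c
    d = rayDir c
    h = ray b d 1ℚ

  rayLine-prev : ∀ c → eval (rayLine c) (point (hub (prev c))) < 0ℚ
  rayLine-prev c₀ = signOf≡neg⇒<0 refl
  rayLine-prev c₁ = signOf≡neg⇒<0 refl
  rayLine-prev c₂ = signOf≡neg⇒<0 refl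

  rayLine-next : ∀ c → 0ℚ ≤ eval (rayLine c) (point (hub (next c)))
  rayLine-next c₀ = signOf≢neg⇒0≤ λ ()
  rayLine-next c₁ = signOf≢neg⇒0≤ λ ()
  rayLine-next c₂ = signOf≢neg⇒0≤ λ ()

  data Shape : Set where
    hubˢ leafˢ : Colour → Shape

  shape : Label → Shape
  shape (hub c)    = hubˢ c
  shape (leaf c _) = leafˢ c

  sideSign : Colour → Shape → Sign
  sideSign c (hubˢ d)  = if does (c ≟ᶜ d) then pos else zer
  sideSign c (leafˢ d) = if does (c ≟ᶜ d) then neg else pos

  leaf-negative : ∀ f d q → signOf (eval f (rayBase d)) ≢ pos → signOf (slope f (rayDir d)) ≡ neg →
                  signOf (eval f (point (leaf d q))) ≡ neg
  leaf-negative f d q fB fD = signOf-ray-neg f (rayBase d) (rayDir d) fB fD (offset-positive q)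

  leaf-positive : ∀ f d q → signOf (eval f (rayBase d)) ≡ pos → signOf (slope f (rayDir d)) ≢ neg →
                  signOf (eval f (point (leaf d q))) ≡ pos
  leaf-positive f d q fB fD = signOf-ray-pos f (rayBase d) (rayDir d) fB fD (<⇒≤ (offset-positive q))

  signOf-sideLine : ∀ c d → signOf (eval (sideLine c) (point d)) ≡ sideSign c (shape d)
  signOf-sideLine c₀ (hub c₀) = refl
  signOf-sideLine c₀ (hub c₁) = refl
  signOf-sideLine c₀ (hub c₂) = refl
  signOf-sideLine c₁ (hub c₀) = refl
  signOf-sideLine c₁ (hub c₁) = refl
  signOf-sideLine c₁ (hub c₂) = refl
  signOf-sideLine c₂ (hub c₀) = refl
  signOf-sideLine c₂ (hub c₁) = refl
  signOf-sideLine c₂ (hub c₂) = refl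
  signOf-sideLine c₀ (leaf c₀ q) = leaf-negative (sideLine c₀) c₀ q (λ ()) refl
  signOf-sideLine c₁ (leaf c₁ q) = leaf-negative (sideLine c₁) c₁ q (λ ()) refl
  signOf-sideLine c₂ (leaf c₂ q) = leaf-negative (sideLine c₂) c₂ q (λ ()) refl
  signOf-sideLine c₀ (leaf c₁ q) = leaf-positive (sideLine c₀) c₁ q refl (λ ())
  signOf-sideLine c₀ (leaf c₂ q) = leaf-positive (sideLine c₀) c₂ q refl (λ ())
  signOf-sideLine c₁ (leaf c₀ q) = leaf-positive (sideLine c₁) c₀ q refl (λ ())
  signOf-sideLine c₁ (leaf c₂ q) = leaf-positive (sideLine c₁) c₂ q refl (λ ())
  signOf-sideLine c₂ (leaf c₀ q) = leaf-positive (sideLine c₂) c₀ q refl (λ ())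
  signOf-sideLine c₂ (leaf c₁ q) = leaf-positive (sideLine c₂) c₁ q refl (λ ())

  -- Which side of each triangle side a vertex lies on determines it up to its level.
  signature : Point → Sign × Sign × Sign
  signature X = signOf (eval (sideLine c₀) X) , signOf (eval (sideLine c₁) X) , signOf (eval (sideLine c₂) X)

  decode : Sign × Sign × Sign → Shape
  decode (pos , zer , zer) = hubˢ c₀
  decode (zer , pos , zer) = hubˢ c₁
  decode (zer , zer , pos) = hubˢ c₂
  decode (neg , _   , _  ) = leafˢ c₀
  decode (_   , neg , _  ) = leafˢ c₁
  decode _                 = leafˢ c₂

  decode-signature : ∀ d → decode (signature (point d)) ≡ shape d
  decode-signature d =
    trans (cong decode (cong₂ _,_ (signOf-sideLine c₀ d)
                          (cong₂ _,_ (signOf-sideLine c₁ d) (signOf-sideLine c₂ d))))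
          (decode-sideSigns (shape d))
    where
    decode-sideSigns : ∀ s → decode (sideSign c₀ s , sideSign c₁ s , sideSign c₂ s) ≡ s
    decode-sideSigns (hubˢ c₀)  = refl
    decode-sideSigns (hubˢ c₁)  = refl
    decode-sideSigns (hubˢ c₂)  = refl
    decode-sideSigns (leafˢ c₀) = refl
    decode-sideSigns (leafˢ c₁) = refl
    decode-sideSigns (leafˢ c₂) = refl

  point-injective : Injective _≡_ _≡_ point
  point-injective {d} {e} eq
    with trans (sym (decode-signature d)) (trans (cong (decode ∘ signature) eq) (decode-signature e))
  point-injective {hub _}    {hub _}    _  | refl = refl
  point-injective {leaf c q} {leaf _ r} eq | refl =
    cong (leaf c) (sym (spokeLine-leaf c false q r
      (trans (cong (eval (spokeLine c false q)) (sym eq)) (lineThrough-end (hubPoint (next c)) (point (leaf c q))))))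

  sideLine-end : ∀ c {w} → Endpoint w (side c) → eval (sideLine c) (point w) ≡ 0ℚ
  sideLine-end c (atSource refl) = lineThrough-start (hubPoint (next c)) (hubPoint (prev c))
  sideLine-end c (atTarget refl) = lineThrough-end (hubPoint (next c)) (hubPoint (prev c))

  sideLine-hub : ∀ c → eval (sideLine c) (point (hub c)) ≢ 0ℚ
  sideLine-hub c₀ = signOf≢zer⇒≢0 λ ()
  sideLine-hub c₁ = signOf≢zer⇒≢0 λ ()
  sideLine-hub c₂ = signOf≢zer⇒≢0 λ ()

  sideLine-leaf : ∀ c q → eval (sideLine c) (point (leaf c q)) < 0ℚ
  sideLine-leaf c q = signOf≡neg⇒<0
    (trans (signOf-sideLine c (leaf c q)) (cong (λ b → if b then neg else pos) (dec-true (c ≟ᶜ c) refl)))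

  sideLine-nonNeg : ∀ c w → (∀ q → w ≢ leaf c q) → 0ℚ ≤ eval (sideLine c) (point w)
  sideLine-nonNeg c w notLeaf = signOf≢neg⇒0≤ λ eq → notNeg w notLeaf (trans (sym (signOf-sideLine c w)) eq)
    where
    notNeg : ∀ w → (∀ q → w ≢ leaf c q) → sideSign c (shape w) ≢ neg
    notNeg (hub d) _ eq with does (c ≟ᶜ d)
    notNeg (hub d) _ () | true
    notNeg (hub d) _ () | false
    notNeg (leaf d q) notLeaf eq with c ≟ᶜ d
    notNeg (leaf d q) notLeaf () | no _
    notNeg (leaf d q) notLeaf _  | yes refl = notLeaf q refl

  zero-onSide : ∀ c w → sideSign c (shape w) ≡ zer → Endpoint w (side c)
  zero-onSide c (hub d) eq with c ≟ᶜ d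
  zero-onSide c (hub d) () | yes _
  zero-onSide c (hub d) _  | no c≢d = [ atSource ∘ cong hub , atTarget ∘ cong hub ]′ (colour-cases c≢d)
  zero-onSide c (leaf d _) eq with does (c ≟ᶜ d)
  zero-onSide c (leaf d _) () | true
  zero-onSide c (leaf d _) () | false

  hubOf-onSide : ∀ c s → Endpoint (hub (hubOf c s)) (side c)
  hubOf-onSide c false = atSource refl
  hubOf-onSide c true  = atTarget refl

  -- A spoke of colour c runs from the line of the side opposite hub c into the open half-plane
  -- containing only the leaves of colour c.
  spoke-touch : ∀ c s q {X} → OnEdge (spoke c s q) X → 0ℚ ≤ eval (sideLine c) X → X ≡ point (hub (hubOf c s))
  spoke-touch c s q = onSegment-touch (sideLine c) (sideLine-end c (hubOf-onSide c s)) (sideLine-leaf c q)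

  vertexOnEdge : VerticesOffEdges
  vertexOnEdge (side c) w on =
    zero-onSide c w (trans (sym (signOf-sideLine c w)) (cong signOf (onSegment-onLine on)))
  vertexOnEdge (spoke c s q) (hub d) on =
    atSource (point-injective (spoke-touch c s q on (sideLine-nonNeg c (hub d) λ _ ())))
  vertexOnEdge (spoke c s q) (leaf d r) on with c ≟ᶜ d
  ... | yes refl = atTarget (cong (leaf c) (spokeLine-leaf c s q r (onSegment-onLine on)))
  ... | no c≢d   = atSource (point-injective
    (spoke-touch c s q on (sideLine-nonNeg c (leaf d r) λ _ eq → c≢d (sym (cong colour eq)))))

  meetAt : ∀ ε ε′ {X} z → Endpoint z ε → X ≡ point z → OnEdge ε′ X → Meet ε ε′ X
  meetAt ε ε′ z z∈ε refl on′ = meet z z∈ε (vertexOnEdge ε′ z on′) refl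

  spokeMeets : ∀ c s q ε → (∀ r → source ε ≢ leaf c r) → (∀ r → target ε ≢ leaf c r) →
               ∀ {X} → OnEdge (spoke c s q) X → OnEdge ε X → Meet (spoke c s q) ε X
  spokeMeets c s q ε src tgt on on′ =
    meetAt (spoke c s q) ε (hub (hubOf c s)) (atSource refl)
      (spoke-touch c s q on (onSegment-nonNeg (sideLine c) (sideLine-nonNeg c _ src) (sideLine-nonNeg c _ tgt) on′))
      on′

  sharedHub : ∀ c d e {X} → Endpoint (hub e) (side c) → Endpoint (hub e) (side d) →
              OnEdge (side c) X → OnSegment (point (hub e)) (point (hub c)) X → Meet (side c) (side d) X
  sharedHub c d e e∈c e∈d on seg =
    meet (hub e) e∈c e∈d
      (onSegment-root (sideLine c) (sideLine-end c e∈c) (sideLine-hub c) seg (onSegment-onLine on))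

  sidesMeet : ∀ c d → c ≢ d → ∀ {X} → OnEdge (side c) X → OnEdge (side d) X → Meet (side c) (side d) X
  sidesMeet c₀ c₁ _ on on′ = sharedHub c₀ c₁ c₂ (atTarget refl) (atSource refl) on on′
  sidesMeet c₀ c₂ _ on on′ = sharedHub c₀ c₂ c₁ (atSource refl) (atTarget refl) on (onSegment-sym on′)
  sidesMeet c₁ c₀ _ on on′ = sharedHub c₁ c₀ c₂ (atSource refl) (atTarget refl) on (onSegment-sym on′)
  sidesMeet c₁ c₂ _ on on′ = sharedHub c₁ c₂ c₀ (atTarget refl) (atSource refl) on on′
  sidesMeet c₂ c₀ _ on on′ = sharedHub c₂ c₀ c₁ (atTarget refl) (atSource refl) on on′
  sidesMeet c₂ c₁ _ on on′ = sharedHub c₂ c₁ c₀ (atSource refl) (atTarget refl) on (onSegment-sym on′)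
  sidesMeet c₀ c₀ c≢c = contradiction refl c≢c
  sidesMeet c₁ c₁ c≢c = contradiction refl c≢c
  sidesMeet c₂ c₂ c≢c = contradiction refl c≢c

  -- The line of the ray of colour c separates the two hubs its leaves are joined to.
  oppositeSpokesMeet : ∀ c q r {X} → OnEdge (spoke c true q) X → OnEdge (spoke c false r) X →
                       Meet (spoke c true q) (spoke c false r) X
  oppositeSpokesMeet c q r on on′ =
    meetAt (spoke c true q) (spoke c false r) (leaf c q) (atTarget refl)
      (onSegment-touch (rayLine c) (rayLine-leaf c q) (rayLine-prev c) (onSegment-sym on)
         (onSegment-nonNeg (rayLine c) (rayLine-next c) (≤-reflexive (sym (rayLine-leaf c r))) on′))
      on′

  sameHubSpokesMeet : ∀ c s q r → q ≢ r → ∀ {X} → OnEdge (spoke c s q) X → OnEdge (spoke c s r) X →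
                      Meet (spoke c s q) (spoke c s r) X
  sameHubSpokesMeet c s q r q≢r on on′ =
    meet (hub (hubOf c s)) (atSource refl) (atSource refl)
      (onSegment-root (spokeLine c s q) (lineThrough-start (point (hub (hubOf c s))) (point (leaf c q)))
         (λ eq → q≢r (sym (spokeLine-leaf c s q r eq))) on′ (onSegment-onLine on))

  sameColourSpokesMeet : ∀ c s s′ q r → spoke c s q ≢ spoke c s′ r → ∀ {X} →
                         OnEdge (spoke c s q) X → OnEdge (spoke c s′ r) X → Meet (spoke c s q) (spoke c s′ r) X
  sameColourSpokesMeet c true  false q r _  = oppositeSpokesMeet c q r
  sameColourSpokesMeet c false true  q r _  on on′ = Meet-sym (oppositeSpokesMeet c r q on′ on)
  sameColourSpokesMeet c true  true  q r ne = sameHubSpokesMeet c true q r (ne ∘ cong (spoke c true))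
  sameColourSpokesMeet c false false q r ne = sameHubSpokesMeet c false q r (ne ∘ cong (spoke c false))

  edgesMeet : EdgesMeetAtEnds
  edgesMeet (side c)      (side d)       ne = sidesMeet c d (ne ∘ cong side)
  edgesMeet (side c)      (spoke d s r)  _ on on′ = Meet-sym (spokeMeets d s r (side c) (λ _ ()) (λ _ ()) on′ on)
  edgesMeet (spoke c s q) (side d)       _  = spokeMeets c s q (side d) (λ _ ()) (λ _ ())
  edgesMeet (spoke c s q) (spoke d s′ r) ne with c ≟ᶜ d
  ... | yes refl = sameColourSpokesMeet c s s′ q r ne
  ... | no c≢d   = spokeMeets c s q (spoke d s′ r) (λ _ ()) (λ _ eq → c≢d (sym (cong colour eq)))

  spokeJoining : ∀ c d q → c ≢ d → ∃ (Joins (hub c) (leaf d q))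
  spokeJoining c d q c≢d with colour-cases (≢-sym c≢d)
  ... | inj₁ refl = spoke d false q , forwards refl refl
  ... | inj₂ refl = spoke d true q , forwards refl refl

  edgeOf : ∀ d e → adjacent d e ≡ true → ∃ (Joins d e)
  edgeOf (hub c₀)   (hub c₁)   _  = side c₂ , forwards  refl refl
  edgeOf (hub c₁)   (hub c₀)   _  = side c₂ , backwards refl refl
  edgeOf (hub c₁)   (hub c₂)   _  = side c₀ , forwards  refl refl
  edgeOf (hub c₂)   (hub c₁)   _  = side c₀ , backwards refl refl
  edgeOf (hub c₂)   (hub c₀)   _  = side c₁ , forwards  refl refl
  edgeOf (hub c₀)   (hub c₂)   _  = side c₁ , backwards refl refl
  edgeOf (hub c)    (leaf d q) cd = spokeJoining c d q (Distinct⇒≢ cd)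
  edgeOf (leaf d q) (hub c)    dc = Data.Product.map₂ Joins-sym (spokeJoining c d q (≢-sym (Distinct⇒≢ dc)))
  edgeOf (hub c₀)   (hub c₀)   ()
  edgeOf (hub c₁)   (hub c₁)   ()
  edgeOf (hub c₂)   (hub c₂)   ()
  edgeOf (leaf _ _) (leaf _ _) ()

  family-planar : ∀ n → Planar (family n)
  family-planar n =
    planar-fromLabelling (family n) label label-injective point-injective
      (λ u v → edgeOf (label u) (label v)) vertexOnEdge edgesMeet

open Geometry

open import Data.Nat using (ℕ; suc; _+_; _*_; _≤_)
open import Data.Nat.Properties using (m≤m+n)
open import Data.Nat.Tactic.RingSolver using (solve-∀)
open import Data.Product using (Σ; _×_; _,_)
open import Relation.Binary.PropositionalEquality using (_≡_; sym; trans; cong; subst)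

theorem3 : ∀ (m : ℕ) → Σ ℕ λ n → m ≤ n × Σ (Graph n) λ G → PathPairable G × Planar G × 3 * maxDegree G ≡ 2 * n
theorem3 m =
  suc M * 3 , m≤n , family (suc M * 3) , family-pathPairable (M * 3) (3 + 3 * m , even m) ,
  family-planar (suc M * 3) , trans (cong (3 *_) (maxDegree-family M)) (ratio (suc M))
  where
  -- With M = 2m + 1 leaves of each colour, n = 3(M + 1) is even.
  M : ℕ
  M = suc (2 * m)
  even : ∀ m → suc (suc (2 * m)) * 3 ≡ 2 * (3 + 3 * m)
  even = solve-∀
  ratio : ∀ k → 3 * (k * 2) ≡ 2 * (k * 3)
  ratio = solve-∀
  size : ∀ m → suc (suc (2 * m)) * 3 ≡ m + (6 + 5 * m)
  size = solve-∀
  m≤n : m ≤ suc M * 3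
  m≤n = subst (m ≤_) (sym (size m)) (m≤m+n m (6 + 5 * m))
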